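{- For all integers $m,j,k$, \[ F_kF_{m-2j-k+3}^2+F_{m+1}F_{m-k}=F_{2j+k-2}F_{2m-2j-2k+3}+F_{k+1}F_{m-2j-k+3}F_{m-2j-k+2}. \]
   Context: $F_p$ are the Fibonacci numbers, $F_0=0$, $F_1=1$, $F_{p+1}=F_p+F_{p-1}$, extended to all integers by the recurrence (so $F_{ -p}=(-1)^{p+1}F_p$). -}

module Defs where

open import Data.Nat using (ℕ; zero; suc)
import Data.Nat as ℕ
open import Data.Integer using (ℤ; +_; -[1+_]; -_)

fibℕ : ℕ → ℕ
fibℕ zero = 0
fibℕ (suc zero) = 1
fibℕ (suc (suc n)) = fibℕ (suc n) ℕ.+ fibℕ n

-- Extension to ℤ via F_{-p} = (-1)^{p+1} F_p.
-- For p = n+1:  F_{-(n+1)} = (-1)^{n} F_{n+1}.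
sign : ℕ → ℤ → ℤ
sign zero x = x
sign (suc n) x = - sign n x

F : ℤ → ℤ
F (+ n) = + fibℕ n
F -[1+ n ] = sign n (+ fibℕ (suc n))

-- With n = 2j + k - 2, a = m - 2j - k + 3 and b = m - 2j - 2k + 2, Vajda's identity
-- F(n+a) F(n+b) - F(n) F(n+a+b) = (-1)ⁿ F(a) F(b) rewrites F(m+1) F(m-k) - F(n) F(2m-2j-2k+3)
-- as (-1)ᵏ F(a) F(b), because n ≡ k (mod 2); d'Ocagne's identity
-- F(k+1) F(a-1) - F(k) F(a) = (-1)ᵏ F(b) shows that the remaining terms give the same quantity.
-- Both sides of Vajda's identity satisfy the Fibonacci recurrence in a and in b, so it reduces to
-- the cases a, b ∈ {0, 1}, where it is Cassini's identity F(n+1)² - F(n+1) F(n) - F(n)² = (-1)ⁿ.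
module Submission where

open import Data.Integer using (ℤ; +_; -[1+_]; _+_; _-_; _*_; -_)
open import Data.Integer.Properties
  using ( +-0-abelianGroup; +-commutativeSemigroup; +-assoc; +-identityʳ
        ; *-distribˡ-+; *-distribʳ-+; *-identityˡ; neg-distribˡ-*; neg-involutive )
open import Data.Integer.Tactic.RingSolver using (solve-∀; solve)
open import Data.Nat using (ℕ; zero; suc)
import Data.Nat.Properties as ℕ
open import Data.List using ([]; _∷_)
open import Data.Product using (_×_; _,_; proj₁)
open import Relation.Binary.PropositionalEquality
  using (_≡_; refl; sym; trans; cong; cong₂; subst; module ≡-Reasoning)

open import Algebra.Bundles using (AbelianGroup)
open import Algebra.Properties.Group (AbelianGroup.group +-0-abelianGroup)
  using () renaming (∙-cancelˡ to +-cancelˡ-≡)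
open import Algebra.Properties.CommutativeSemigroup +-commutativeSemigroup
  using () renaming (xy∙z≈xz∙y to +-rightComm; interchange to +-interchange)

open import Defs

open ≡-Reasoning

ℤ-induction : (P : ℤ → Set) → P (+ 0) →
              (∀ n → P n → P (n + + 1)) → (∀ n → P (n + + 1) → P n) →
              ∀ n → P n
ℤ-induction P base up down (+ zero)      = base
ℤ-induction P base up down (+ suc n)     =
  subst P (cong +_ (ℕ.+-comm n 1)) (up (+ n) (ℤ-induction P base up down (+ n)))
ℤ-induction P base up down -[1+ zero ]   = down -[1+ zero ] base
ℤ-induction P base up down -[1+ suc n ]  = down -[1+ suc n ] (ℤ-induction P base up down -[1+ n ])

record IsFibonacciLike (G : ℤ → ℤ) : Set where
  constructor fibonacciLike
  field recurrence : ∀ n → G (n + + 2) ≡ G (n + + 1) + G n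

sign-as-* : ∀ n x → sign n x ≡ sign n (+ 1) * x
sign-as-* zero    x = sym (*-identityˡ x)
sign-as-* (suc n) x = trans (cong -_ (sign-as-* n x)) (neg-distribˡ-* (sign n (+ 1)) x)

F-recurrence : ∀ n → F (n + + 2) ≡ F (n + + 1) + F n
F-recurrence (+ n) rewrite ℕ.+-comm n 2 | ℕ.+-comm n 1 = refl
F-recurrence -[1+ 0 ] = refl
F-recurrence -[1+ 1 ] = refl
F-recurrence -[1+ suc (suc n) ] = begin
  sign n b                                ≡⟨ sign-as-* n b ⟩
  s * b                                   ≡⟨ alternating s a b ⟩
  - (s * a) + - - (s * (a + b))           ≡⟨ sym (cong₂ (λ u v → - u + - - v) (sign-as-* n a) (sign-as-* n (a + b))) ⟩
  - sign n a + - - sign n (a + b)         ∎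
  where
  s a b : ℤ
  s = sign n (+ 1)
  a = + fibℕ (suc (suc n))
  b = + fibℕ (suc n)
  alternating : ∀ s a b → s * b ≡ - (s * a) + - - (s * (a + b))
  alternating = solve-∀

F-fibonacciLike : IsFibonacciLike F
F-fibonacciLike = fibonacciLike F-recurrence

fibonacciLike-unique : ∀ {G H} → IsFibonacciLike G → IsFibonacciLike H →
                       G (+ 0) ≡ H (+ 0) → G (+ 1) ≡ H (+ 1) → ∀ n → G n ≡ H n
fibonacciLike-unique {G} {H} (fibonacciLike recG) (fibonacciLike recH) eq₀ eq₁ n =
  proj₁ (ℤ-induction (λ n → G n ≡ H n × G (n + + 1) ≡ H (n + + 1)) (eq₀ , eq₁) up down n)
  where
  up : ∀ n → G n ≡ H n × G (n + + 1) ≡ H (n + + 1) →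
       G (n + + 1) ≡ H (n + + 1) × G (n + + 1 + + 1) ≡ H (n + + 1 + + 1)
  up n (p , q) = q , (begin
    G (n + + 1 + + 1)   ≡⟨ cong G (+-assoc n (+ 1) (+ 1)) ⟩
    G (n + + 2)         ≡⟨ recG n ⟩
    G (n + + 1) + G n   ≡⟨ cong₂ _+_ q p ⟩
    H (n + + 1) + H n   ≡⟨ sym (recH n) ⟩
    H (n + + 2)         ≡⟨ cong H (sym (+-assoc n (+ 1) (+ 1))) ⟩
    H (n + + 1 + + 1)   ∎)
  down : ∀ n → G (n + + 1) ≡ H (n + + 1) × G (n + + 1 + + 1) ≡ H (n + + 1 + + 1) →
         G n ≡ H n × G (n + + 1) ≡ H (n + + 1)
  down n (p , q) = +-cancelˡ-≡ (G (n + + 1)) (G n) (H n) (begin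
    G (n + + 1) + G n   ≡⟨ sym (recG n) ⟩
    G (n + + 2)         ≡⟨ cong G (sym (+-assoc n (+ 1) (+ 1))) ⟩
    G (n + + 1 + + 1)   ≡⟨ q ⟩
    H (n + + 1 + + 1)   ≡⟨ cong H (+-assoc n (+ 1) (+ 1)) ⟩
    H (n + + 2)         ≡⟨ recH n ⟩
    H (n + + 1) + H n   ≡⟨ cong (_+ H n) (sym p) ⟩
    G (n + + 1) + H n   ∎) , p

fibonacciLike-reindex : ∀ {G} (f : ℤ → ℤ) → (∀ n d → f (n + d) ≡ f n + d) →
                        IsFibonacciLike G → IsFibonacciLike (λ n → G (f n))
fibonacciLike-reindex {G} f f-translation (fibonacciLike recG) = fibonacciLike λ n → begin
  G (f (n + + 2))             ≡⟨ cong G (f-translation n (+ 2)) ⟩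
  G (f n + + 2)               ≡⟨ recG (f n) ⟩
  G (f n + + 1) + G (f n)     ≡⟨ cong (λ i → G i + G (f n)) (sym (f-translation n (+ 1))) ⟩
  G (f (n + + 1)) + G (f n)   ∎

fibonacciLike-shiftˡ : ∀ {G} s → IsFibonacciLike G → IsFibonacciLike (λ n → G (s + n))
fibonacciLike-shiftˡ {G} s = fibonacciLike-reindex {G} (λ n → s + n) (λ n d → sym (+-assoc s n d))

fibonacciLike-shiftʳ : ∀ {G} s → IsFibonacciLike G → IsFibonacciLike (λ n → G (n + s))
fibonacciLike-shiftʳ {G} s = fibonacciLike-reindex {G} (λ n → n + s) (λ n d → +-rightComm n d s)

fibonacciLike-*ˡ : ∀ {G} c → IsFibonacciLike G → IsFibonacciLike (λ n → c * G n)
fibonacciLike-*ˡ {G} c (fibonacciLike recG) = fibonacciLike λ n →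
  trans (cong (c *_) (recG n)) (*-distribˡ-+ c (G (n + + 1)) (G n))

fibonacciLike-*ʳ : ∀ {G} c → IsFibonacciLike G → IsFibonacciLike (λ n → G n * c)
fibonacciLike-*ʳ {G} c (fibonacciLike recG) = fibonacciLike λ n →
  trans (cong (_* c) (recG n)) (*-distribʳ-+ c (G (n + + 1)) (G n))

fibonacciLike-+ : ∀ {G H} → IsFibonacciLike G → IsFibonacciLike H →
                  IsFibonacciLike (λ n → G n + H n)
fibonacciLike-+ {G} {H} (fibonacciLike recG) (fibonacciLike recH) = fibonacciLike λ n →
  trans (cong₂ _+_ (recG n) (recH n)) (+-interchange (G (n + + 1)) (G n) (H (n + + 1)) (H n))

-- This is (-1)ⁿ, but only its 2-periodicity is needed.
cassini : ℤ → ℤ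
cassini n = F (n + + 1) * F (n + + 1) - F (n + + 1) * F n - F n * F n

cassini-suc : ∀ n → cassini (n + + 1) ≡ - cassini n
cassini-suc n =
  trans (cong (λ c → c * c - c * b - b * b) (trans (cong F (+-assoc n (+ 1) (+ 1))) (F-recurrence n)))
        (alternates b (F n))
  where
  b : ℤ
  b = F (n + + 1)
  alternates : ∀ b a → (b + a) * (b + a) - (b + a) * b - b * b ≡ - (b * b - b * a - a * a)
  alternates = solve-∀

cassini-+-2* : ∀ n t → cassini (n + + 2 * t) ≡ cassini n
cassini-+-2* n = ℤ-induction (λ t → cassini (n + + 2 * t) ≡ cassini n) base up down
  where
  twice : ∀ i → cassini (i + + 1 + + 1) ≡ cassini i
  twice i = trans (cassini-suc (i + + 1)) (trans (cong -_ (cassini-suc i)) (neg-involutive (cassini i)))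
  index : ∀ i t → i + + 2 * (t + + 1) ≡ i + + 2 * t + + 1 + + 1
  index = solve-∀
  base : cassini (n + + 2 * + 0) ≡ cassini n
  base = cong cassini (+-identityʳ n)
  up : ∀ t → cassini (n + + 2 * t) ≡ cassini n → cassini (n + + 2 * (t + + 1)) ≡ cassini n
  up t h = trans (cong cassini (index n t)) (trans (twice (n + + 2 * t)) h)
  down : ∀ t → cassini (n + + 2 * (t + + 1)) ≡ cassini n → cassini (n + + 2 * t) ≡ cassini n
  down t h = trans (sym (twice (n + + 2 * t))) (trans (cong cassini (sym (index n t))) h)

dOcagne : ∀ n b → F (n + + 1) * F (n + b) ≡ F n * F (n + + 1 + b) + cassini n * F (+ 1) * F b
dOcagne n = fibonacciLike-unique
  (fibonacciLike-*ˡ (F (n + + 1)) (fibonacciLike-shiftˡ n F-fibonacciLike))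
  (fibonacciLike-+ (fibonacciLike-*ˡ (F n) (fibonacciLike-shiftˡ (n + + 1) F-fibonacciLike))
                   (fibonacciLike-*ˡ (cassini n * F (+ 1)) F-fibonacciLike))
  base₀ base₁
  where
  base₀ : F (n + + 1) * F (n + + 0) ≡ F n * F (n + + 1 + + 0) + cassini n * F (+ 1) * F (+ 0)
  base₀ rewrite +-identityʳ n | +-identityʳ (n + + 1) = identity (F (n + + 1)) (F n) (cassini n)
    where
    identity : ∀ b a c → b * a ≡ a * b + c * + 1 * + 0
    identity = solve-∀
  base₁ : F (n + + 1) * F (n + + 1) ≡ F n * F (n + + 1 + + 1) + cassini n * F (+ 1) * F (+ 1)
  base₁ rewrite +-assoc n (+ 1) (+ 1) | F-recurrence n = identity (F (n + + 1)) (F n)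
    where
    identity : ∀ b a → b * b ≡ a * (b + a) + (b * b - b * a - a * a) * + 1 * + 1
    identity = solve-∀

vajda : ∀ n a b → F (n + a) * F (n + b) ≡ F n * F (n + a + b) + cassini n * F a * F b
vajda n a b = fibonacciLike-unique
  (fibonacciLike-*ʳ (F (n + b)) (fibonacciLike-shiftˡ n F-fibonacciLike))
  (fibonacciLike-+ (fibonacciLike-*ˡ (F n) (fibonacciLike-shiftˡ n (fibonacciLike-shiftʳ b F-fibonacciLike)))
                   (fibonacciLike-*ʳ (F b) (fibonacciLike-*ˡ (cassini n) F-fibonacciLike)))
  base₀ (dOcagne n b) a
  where
  base₀ : F (n + + 0) * F (n + b) ≡ F n * F (n + + 0 + b) + cassini n * F (+ 0) * F b
  base₀ rewrite +-identityʳ n = identity (F n) (F (n + b)) (cassini n) (F b)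
    where
    identity : ∀ x y c z → x * y ≡ x * y + c * + 0 * z
    identity = solve-∀

propositionA4-reindexed : ∀ k b t → let n = k + + 2 * t; a = k + b + + 1 in
  F k * (F a * F a) + F (n + a) * F (n + b)
    ≡ F n * F (n + a + b) + F (k + + 1) * F a * F (k + b)
propositionA4-reindexed k b t = begin
  F k * (A * A) + F (n + a) * F (n + b)
    ≡⟨ cong (λ y → F k * (A * A) + y) (vajda n a b) ⟩
  F k * (A * A) + (W + cassini n * A * F b)
    ≡⟨ cong (λ c → F k * (A * A) + (W + c * A * F b)) (cassini-+-2* k t) ⟩
  F k * (A * A) + (W + cassini k * A * F b)
    ≡⟨ regroup (F k) A W (cassini k) (F b) ⟩
  W + A * (F k * A + cassini k * F b * F (+ 1))
    ≡⟨ cong (λ y → W + A * y) (sym (vajda k b (+ 1))) ⟩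
  W + A * (F (k + b) * F (k + + 1))
    ≡⟨ cong (λ y → W + y) (rotate A (F (k + b)) (F (k + + 1))) ⟩
  W + F (k + + 1) * A * F (k + b)
    ∎
  where
  n a A W : ℤ
  n = k + + 2 * t
  a = k + b + + 1
  A = F a
  W = F n * F (n + a + b)
  regroup : ∀ K A W c B → K * (A * A) + (W + c * A * B) ≡ W + A * (K * A + c * B * + 1)
  regroup = solve-∀
  rotate : ∀ A X Y → A * (X * Y) ≡ Y * A * X
  rotate = solve-∀

propositionA4 : ∀ (m j k : ℤ) →
    F k * (F (m - + 2 * j - k + + 3) * F (m - + 2 * j - k + + 3))
      + F (m + + 1) * F (m - k)
    ≡ F (+ 2 * j + k - + 2) * F (+ 2 * m - + 2 * j - + 2 * k + + 3)
      + F (k + + 1) * F (m - + 2 * j - k + + 3) * F (m - + 2 * j - k + + 2)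
propositionA4 m j k =
  trans (cong₂ _+_ (cong (λ p → F k * (F p * F p)) a-index) (cong₂ (λ p q → F p * F q) na-index nb-index))
    (trans (propositionA4-reindexed k (m - + 2 * j - + 2 * k + + 2) (j - + 1))
      (sym (cong₂ _+_ (cong₂ (λ p q → F p * F q) n-index nab-index)
                      (cong₂ (λ p q → F (k + + 1) * F p * F q) a-index kb-index))))
  where
  a-index : m - + 2 * j - k + + 3 ≡ k + (m - + 2 * j - + 2 * k + + 2) + + 1
  a-index = solve (m ∷ j ∷ k ∷ [])
  na-index : m + + 1 ≡ k + + 2 * (j - + 1) + (k + (m - + 2 * j - + 2 * k + + 2) + + 1)
  na-index = solve (m ∷ j ∷ k ∷ [])
  nb-index : m - k ≡ k + + 2 * (j - + 1) + (m - + 2 * j - + 2 * k + + 2)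
  nb-index = solve (m ∷ j ∷ k ∷ [])
  n-index : + 2 * j + k - + 2 ≡ k + + 2 * (j - + 1)
  n-index = solve (m ∷ j ∷ k ∷ [])
  nab-index : + 2 * m - + 2 * j - + 2 * k + + 3
              ≡ k + + 2 * (j - + 1) + (k + (m - + 2 * j - + 2 * k + + 2) + + 1) + (m - + 2 * j - + 2 * k + + 2)
  nab-index = solve (m ∷ j ∷ k ∷ [])
  kb-index : m - + 2 * j - k + + 2 ≡ k + (m - + 2 * j - + 2 * k + + 2)
  kb-index = solve (m ∷ j ∷ k ∷ [])
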